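{- Let $Q$ be a bipartite recurrent quiver. For all $u,v\in\mathrm{Vert}(Q)$ and all $t\in\mathbb{Z}$ with $t+\epsilon_v$ even, $\mathfrak{t}^{\delta_u}_v(t)=\deg_{\max}(u,T_v(t))$.
   Context: A quiver is a finite directed graph without loops and directed 2-cycles. $Q$ is bipartite with bipartition $\epsilon:\mathrm{Vert}(Q)\to\{0,1\}$, and recurrent if each of the simultaneous mutations at all vertices with $\epsilon=1$, resp. with $\epsilon=0$, turns $Q$ into $Q$ with all arrows reversed (mutation $\mu_v$: for each pair of arrows $u\to v\to w$ add $u\to w$; reverse arrows at $v$; cancel directed 2-cycles). $T$-system: $T_v(\epsilon_v)=x_v$ and $T_v(t+1)T_v(t-1)=\prod_{u\to v}T_u(t)+\prod_{v\to w}T_w(t)$ for $t+\epsilon_v$ even; each $T_v(t)$ is a Laurent polynomial in the $x$'s. Tropical $T$-system for $\lambda:\mathrm{Vert}(Q)\to\mathbb{R}$: $\mathfrak{t}^\lambda_v(\epsilon_v)=\lambda(v)$, $\mathfrak{t}^\lambda_v(t+1)+\mathfrak{t}^\lambda_v(t-1)=\max\left(\sum_{u\to v}\mathfrak{t}^\lambda_u(t),\sum_{v\to w}\mathfrak{t}^\lambda_w(t)\right)$. $\delta_u(v)=1$ if $v=u$ and $0$ otherwise. For a Laurent polynomial $p$, $\deg_{\max}(u,p)$ is the maximal degree of $x_u$ in $p$ viewed as a Laurent polynomial in $x_u$ with the other variables as constants. -}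

module Defs where

open import Data.Nat as ℕ using (ℕ; zero; suc)
open import Data.Integer as ℤ using (ℤ; +_; _⊔_)
open import Data.Integer.Divisibility using (_∣_)
open import Data.Bool using (Bool; true; false; if_then_else_; not)
open import Data.Fin using (Fin)
open import Data.Fin.Properties using () renaming (_≟_ to _≟F_)
open import Data.Vec using (Vec; replicate; zipWith; lookup; _[_]≔_)
open import Data.Vec.Properties using (≡-dec)
open import Data.List using (List; []; _∷_; _++_; concatMap; map; foldr; allFin)
open import Data.Sum using (_⊎_)
open import Data.Product using (_×_; _,_; ∃)
open import Relation.Nullary using (¬_; yes; no)
open import Relation.Binary.PropositionalEquality using (_≡_; _≢_)

Mat : ℕ → Set
Mat n = Fin n → Fin n → ℕ

record Quiver (n : ℕ) : Set where
  field
    arr     : Mat n                                  -- arr i j = #arrows i → j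
    noLoop  : ∀ i → arr i i ≡ 0
    no2cyc  : ∀ i j → (arr i j ≡ 0) ⊎ (arr j i ≡ 0)

open Quiver public

-- mutation at k: add i → j for each path i → k → j, reverse arrows at k,
-- then cancel directed 2-cycles.
mutate : ∀ {n} → Fin n → Mat n → Mat n
mutate {n} k a i j = c i j ℕ.∸ c j i
  where
  c : Mat n
  c x y with x ≟F k | y ≟F k
  ... | yes _ | _     = a y x
  ... | no _  | yes _ = a y x
  ... | no _  | no _  = a x y ℕ.+ a x k ℕ.* a k y

mutateAt : ∀ {n} → (Fin n → Bool) → Mat n → Mat n
mutateAt {n} P a = foldr (λ k acc → if P k then mutate k acc else acc) a (allFin n)

sameBool : Bool → Bool → Bool
sameBool x b = if x then b else not b

IsBipartite : ∀ {n} → Quiver n → (Fin n → Bool) → Set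
IsBipartite Q ε = ∀ i j → 0 ℕ.< arr Q i j → ε i ≢ ε j

IsRecurrent : ∀ {n} → Quiver n → (Fin n → Bool) → Set
IsRecurrent Q ε = ∀ (b : Bool) i j →
  mutateAt (λ k → sameBool (ε k) b) (arr Q) i j ≡ arr Q j i

-- Laurent polynomials in x_0 … x_{n-1} over ℤ: finite lists of terms
-- (coefficient, exponent vector), compared by their coefficient functions.

Exp : ℕ → Set
Exp n = Vec ℤ n

Laurent : ℕ → Set
Laurent n = List (ℤ × Exp n)

coeff : ∀ {n} → Laurent n → Exp n → ℤ
coeff [] m = + 0
coeff ((c , e) ∷ p) m with ≡-dec ℤ._≟_ e m
... | yes _ = c ℤ.+ coeff p m
... | no _  = coeff p m

infix 4 _≈L_
_≈L_ : ∀ {n} → Laurent n → Laurent n → Set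
p ≈L q = ∀ m → coeff p m ≡ coeff q m

_+L_ : ∀ {n} → Laurent n → Laurent n → Laurent n
_+L_ = _++_

_*L_ : ∀ {n} → Laurent n → Laurent n → Laurent n
p *L q = concatMap (λ { (c , e) → map (λ { (d , f) → (c ℤ.* d , zipWith ℤ._+_ e f) }) q }) p

oneL : ∀ {n} → Laurent n
oneL {n} = (+ 1 , replicate n (+ 0)) ∷ []

_^L_ : ∀ {n} → Laurent n → ℕ → Laurent n
p ^L zero  = oneL
p ^L suc k = p *L (p ^L k)

varL : ∀ {n} → Fin n → Laurent n
varL {n} v = (+ 1 , (replicate n (+ 0) [ v ]≔ + 1)) ∷ []

prodL : ∀ {n} → (Fin n → Laurent n) → (Fin n → ℕ) → Laurent n
prodL {n} f m = foldr (λ i acc → (f i ^L m i) *L acc) oneL (allFin n)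

IsDegMax : ∀ {n} → Fin n → Laurent n → ℤ → Set
IsDegMax u p d =
  (∃ λ m → coeff p m ≢ + 0 × lookup m u ≡ d) ×
  (∀ m → coeff p m ≢ + 0 → lookup m u ℤ.≤ d)

εℤ : Bool → ℤ
εℤ false = + 0
εℤ true  = + 1

EvenZ : ℤ → Set
EvenZ t = + 2 ∣ t

IsTSystem : ∀ {n} → Quiver n → (Fin n → Bool) → (Fin n → ℤ → Laurent n) → Set
IsTSystem Q ε T =
  (∀ v → T v (εℤ (ε v)) ≈L varL v) ×
  (∀ v t → ¬ EvenZ (t ℤ.+ εℤ (ε v)) →
     T v (t ℤ.+ + 1) *L T v (t ℤ.- + 1)
       ≈L prodL (λ u → T u t) (λ u → arr Q u v)
          +L prodL (λ w → T w t) (λ w → arr Q v w))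

sumZ : ∀ {n} → (Fin n → ℤ) → ℤ
sumZ {n} f = foldr (λ i acc → f i ℤ.+ acc) (+ 0) (allFin n)

IsTropTSystem : ∀ {n} → Quiver n → (Fin n → Bool) → (Fin n → ℤ) → (Fin n → ℤ → ℤ) → Set
IsTropTSystem Q ε lam 𝔱 =
  (∀ v → 𝔱 v (εℤ (ε v)) ≡ lam v) ×
  (∀ v t → ¬ EvenZ (t ℤ.+ εℤ (ε v)) →
     𝔱 v (t ℤ.+ + 1) ℤ.+ 𝔱 v (t ℤ.- + 1)
       ≡ sumZ (λ u → + arr Q u v ℤ.* 𝔱 u t) ⊔ sumZ (λ w → + arr Q v w ℤ.* 𝔱 w t))

δ : ∀ {n} → Fin n → Fin n → ℤ
δ u v with u ≟F v
... | yes _ = + 1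
... | no _  = + 0

module Submission where

-- Fix the vertex u and order exponent vectors lexicographically, comparing
-- the exponent of x_u first.  For a Laurent polynomial p, "p has a positive
-- lead of degree d" means: the largest monomial of p for this order has a
-- positive coefficient and x_u-exponent d.  Then d = deg_max(u, p), and the
-- property is compatible with the operations of the T-system:
--   * products add lead degrees, powers multiply them;
--   * sums take the maximum (positive leads cannot cancel);
--   * if a · b = r and b, r have positive leads, so does a, with degree
--     deg r - deg b (the lead of a product is the product of the leads).
-- These are exactly the rules of the tropical T-system.  So, by a two-sided
-- induction over time t ∈ ℤ starting from the initial data T_v(ε_v) = x_v
-- (lead degree δ_u(v)), every T_v(t) has a positive lead of degree 𝔱_v(t).
-- Recurrence of Q guarantees that a solution T exists; the degree statement
-- only uses that T solves the T-system of a bipartite quiver.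

open import Defs
open import Data.Nat using (ℕ)
open import Data.Integer using (ℤ; _+_)
open import Data.Bool using (Bool)
open import Data.Fin using (Fin)
import Data.Fin.Properties as Fin
open import Data.Nat as ℕ using (zero; suc)
import Data.Nat.Properties as ℕP
open import Data.Integer as ℤ using (+_; -[1+_]; -_; _-_; _*_; _⊔_; _<_; _≤_)
import Data.Integer.Properties as ℤP
open import Data.Integer.Tactic.RingSolver using (solve-∀)
open import Data.Integer.DivMod using (_%ℕ_; _/ℕ_; n%ℕd<d; a≡a%ℕn+[a/ℕn]*n)
import Data.Integer.Divisibility.Signed as Signed
open import Data.Integer.Divisibility using (divides)
open import Data.Bool using (true; false)
open import Data.Vec using (Vec; []; _∷_; zipWith; lookup; replicate; _[_]≔_)
import Data.Vec.Properties as VP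
open import Data.Vec.Properties using (≡-dec)
open import Data.List using (List; []; _∷_; _++_; map; foldr; length; allFin)
open import Data.List.Membership.Propositional using (_∈_)
open import Data.List.Relation.Unary.Any using (here; there)
open import Data.Sum using (_⊎_; inj₁; inj₂)
open import Data.Product using (Σ; _×_; _,_; proj₁; proj₂)
open import Data.Empty using (⊥-elim)
open import Relation.Nullary using (¬_; yes; no)
open import Relation.Nullary.Decidable using (decidable-stable)
open import Relation.Binary using (tri<; tri≈; tri>)
open import Relation.Binary.PropositionalEquality

-- EvenZ is unsigned divisibility; the signed version has the arithmetic.
even⇒signed : ∀ {x} → EvenZ x → + 2 Signed.∣ x
even⇒signed {x} = Signed.∣ᵤ⇒∣ {+ 2} {x}

signed⇒even : ∀ {x} → + 2 Signed.∣ x → EvenZ x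
signed⇒even {x} = Signed.∣⇒∣ᵤ {+ 2} {x}

odd-one : ¬ EvenZ (+ 1)
odd-one (divides zero ())
odd-one (divides (suc (suc _)) ())

even-+ : ∀ {x y} → EvenZ x → EvenZ y → EvenZ (x + y)
even-+ {x} {y} ex ey =
  signed⇒even (Signed.∣m∣n⇒∣m+n {+ 2} {x} {y} (even⇒signed ex) (even⇒signed ey))

even-cancelˡ : ∀ {x y} → EvenZ (x + y) → EvenZ x → EvenZ y
even-cancelˡ {x} {y} exy ex =
  signed⇒even (Signed.∣m+n∣m⇒∣n {+ 2} {x} {y} (even⇒signed exy) (even⇒signed ex))

even-two : EvenZ (+ 2)
even-two = signed⇒even (Signed.divides (+ 1) refl)

even⇒odd-suc : ∀ {x} → EvenZ x → ¬ EvenZ (x + + 1)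
even⇒odd-suc {x} ex ex+1 = odd-one (even-cancelˡ {x} {+ 1} ex+1 ex)

even-or-odd : ∀ x → EvenZ x ⊎ EvenZ (x + + 1)
even-or-odd x with x %ℕ 2 | n%ℕd<d x 2 | a≡a%ℕn+[a/ℕn]*n x 2
... | 0 | _ | x≡ = inj₁ (signed⇒even (Signed.divides (x /ℕ 2) (trans x≡ (ℤP.+-identityˡ _))))
... | 1 | _ | x≡ = inj₂ (signed⇒even (Signed.divides (x /ℕ 2 + + 1)
        (trans (cong (_+ + 1) x≡) (regroup (x /ℕ 2)))))
  where
  regroup : ∀ q → + 1 + q * + 2 + + 1 ≡ (q + + 1) * + 2
  regroup = solve-∀
... | suc (suc _) | ℕ.s≤s (ℕ.s≤s ()) | _

parity-after : ∀ s e → EvenZ (s + + 1 + e) → ¬ EvenZ (s + e) × EvenZ (s - + 1 + e)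
parity-after s e even =
  (λ even' → even⇒odd-suc {s + e} even' (subst EvenZ (shift s e) even)) ,
  even-cancelˡ {+ 2} {s - + 1 + e} (subst EvenZ (shift₂ s e) even) even-two
  where
  shift : ∀ s e → s + + 1 + e ≡ s + e + + 1
  shift = solve-∀
  shift₂ : ∀ s e → s + + 1 + e ≡ + 2 + (s - + 1 + e)
  shift₂ = solve-∀

parity-before : ∀ s e → EvenZ (s - + 1 + e) → ¬ EvenZ (s + e) × EvenZ (s + + 1 + e)
parity-before s e even =
  (λ even' → even⇒odd-suc {s - + 1 + e} even (subst EvenZ (shift s e) even')) ,
  subst EvenZ (shift₂ s e) (even-+ {s - + 1 + e} {+ 2} even even-two)
  where
  shift : ∀ s e → s + e ≡ s - + 1 + e + + 1
  shift = solve-∀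
  shift₂ : ∀ s e → s - + 1 + e + + 2 ≡ s + + 1 + e
  shift₂ = solve-∀

parity-flip : ∀ s a b → ¬ EvenZ (s + εℤ b) → a ≢ b → EvenZ (s + εℤ a)
parity-flip s false false _ a≢b = ⊥-elim (a≢b refl)
parity-flip s true  true  _ a≢b = ⊥-elim (a≢b refl)
parity-flip s false true odd _ with even-or-odd (s + + 0)
... | inj₁ even = even
... | inj₂ even = ⊥-elim (odd (subst EvenZ (cong (_+ + 1) (ℤP.+-identityʳ s)) even))
parity-flip s true false odd _ with even-or-odd (s + + 0)
... | inj₁ even = ⊥-elim (odd even)
... | inj₂ even = subst EvenZ (cong (_+ + 1) (ℤP.+-identityʳ s)) even

ℤ-induction₂ : (P : ℤ → Set) → P (+ 0) → P (+ 1) →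
  (∀ s → P (s - + 1) → P s → P (s + + 1)) →
  (∀ s → P s → P (s + + 1) → P (s - + 1)) →
  ∀ t → P t
ℤ-induction₂ P P0 P1 forward backward = λ
  { (+ k)    → proj₁ (upwards k)
  ; -[1+ k ] → proj₁ (downwards (suc k)) }
  where
  upwards : ∀ k → P (+ k) × P (+ suc k)
  upwards zero = P0 , P1
  upwards (suc k) with upwards k
  ... | Pk , Pk+1 = Pk+1 , subst P (cong +_ (ℕP.+-comm (suc k) 1)) (forward (+ suc k) Pk Pk+1)

  pred-neg : ∀ x → - x - + 1 ≡ - (+ 1 + x)
  pred-neg = solve-∀
  suc-neg : ∀ x → - (+ 1 + x) + + 1 ≡ - x
  suc-neg = solve-∀

  downwards : ∀ k → P (- (+ k)) × P (- (+ k) + + 1)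
  downwards zero = P0 , P1
  downwards (suc k) with downwards k
  ... | P-k , P-k+1 =
    subst P (pred-neg (+ k)) (backward (- (+ k)) P-k P-k+1) ,
    subst P (sym (suc-neg (+ k))) P-k

infixl 6 _⊕_ _⊖_
_⊕_ : ∀ {k} → Vec ℤ k → Vec ℤ k → Vec ℤ k
_⊕_ = zipWith _+_

_⊖_ : ∀ {k} → Vec ℤ k → Vec ℤ k → Vec ℤ k
_⊖_ = zipWith _-_

⊕-comm : ∀ {k} (a b : Vec ℤ k) → a ⊕ b ≡ b ⊕ a
⊕-comm = VP.zipWith-comm ℤP.+-comm

⊕-⊖-cancel : ∀ {k} (e m : Vec ℤ k) → e ⊕ (m ⊖ e) ≡ m
⊕-⊖-cancel []      []      = refl
⊕-⊖-cancel (x ∷ e) (y ∷ m) = cong₂ _∷_ (cancel x y) (⊕-⊖-cancel e m)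
  where
  cancel : ∀ x y → x + (y - x) ≡ y
  cancel = solve-∀

⊕⇒⊖ : ∀ {k} (e f m : Vec ℤ k) → e ⊕ f ≡ m → f ≡ m ⊖ e
⊕⇒⊖ []      []      []      _  = refl
⊕⇒⊖ (x ∷ e) (y ∷ f) (z ∷ m) eq =
  cong₂ _∷_ (trans (cancel x y) (cong (_- x) (VP.∷-injectiveˡ eq)))
            (⊕⇒⊖ e f m (VP.∷-injectiveʳ eq))
  where
  cancel : ∀ x y → y ≡ x + y - x
  cancel = solve-∀

infix 4 _<lex_
data _<lex_ : ∀ {k} → Vec ℤ k → Vec ℤ k → Set where
  here  : ∀ {k x y} {xs ys : Vec ℤ k} → x < y → (x ∷ xs) <lex (y ∷ ys)
  there : ∀ {k x} {xs ys : Vec ℤ k} → xs <lex ys → (x ∷ xs) <lex (x ∷ ys)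

<lex-irrefl : ∀ {k} {a : Vec ℤ k} → ¬ (a <lex a)
<lex-irrefl (here x<x) = ℤP.<-irrefl refl x<x
<lex-irrefl (there p)  = <lex-irrefl p

<lex-trans : ∀ {k} {a b c : Vec ℤ k} → a <lex b → b <lex c → a <lex c
<lex-trans (here p)  (here q)  = here (ℤP.<-trans p q)
<lex-trans (here p)  (there _) = here p
<lex-trans (there _) (here q)  = here q
<lex-trans (there p) (there q) = there (<lex-trans p q)

<lex-compare : ∀ {k} (a b : Vec ℤ k) → a <lex b ⊎ a ≡ b ⊎ b <lex a
<lex-compare []      []      = inj₂ (inj₁ refl)
<lex-compare (x ∷ a) (y ∷ b) with ℤP.<-cmp x y
... | tri< x<y _ _ = inj₁ (here x<y)
... | tri> _ _ y<x = inj₂ (inj₂ (here y<x))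
... | tri≈ _ refl _ with <lex-compare a b
...   | inj₁ a<b        = inj₁ (there a<b)
...   | inj₂ (inj₁ refl) = inj₂ (inj₁ refl)
...   | inj₂ (inj₂ b<a) = inj₂ (inj₂ (there b<a))

-- The order is compatible with addition: it is a monomial order.
<lex-⊕ʳ : ∀ {k} {a b : Vec ℤ k} (c : Vec ℤ k) → a <lex b → a ⊕ c <lex b ⊕ c
<lex-⊕ʳ (z ∷ c) (here p)  = here (ℤP.+-monoˡ-< z p)
<lex-⊕ʳ (z ∷ c) (there p) = there (<lex-⊕ʳ c p)

<lex-head : ∀ {k x y} {xs ys : Vec ℤ k} → (x ∷ xs) <lex (y ∷ ys) → x ≤ y
<lex-head (here p)  = ℤP.<⇒≤ p
<lex-head (there _) = ℤP.≤-refl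

coeff-++ : ∀ {n} (p q : Laurent n) m → coeff (p ++ q) m ≡ coeff p m + coeff q m
coeff-++ []            q m = sym (ℤP.+-identityˡ _)
coeff-++ ((c , e) ∷ p) q m with ≡-dec ℤ._≟_ e m
... | yes _ = trans (cong (λ z → c + z) (coeff-++ p q m)) (sym (ℤP.+-assoc c _ _))
... | no _  = coeff-++ p q m

-- Sum over the terms c·x^e of p of c · g(e) (terms are not merged).
termSum : ∀ {n} → Laurent n → (Exp n → ℤ) → ℤ
termSum []            g = + 0
termSum ((c , e) ∷ p) g = c * g e + termSum p g

coeff-term-* : ∀ {n} c (e : Exp n) (q : Laurent n) m →
  coeff (((c , e) ∷ []) *L q) m ≡ c * coeff q (m ⊖ e)
coeff-term-* c e []            m = sym (ℤP.*-zeroʳ c)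
coeff-term-* c e ((d , f) ∷ q) m with ≡-dec ℤ._≟_ (e ⊕ f) m | ≡-dec ℤ._≟_ f (m ⊖ e)
... | yes _   | yes _ = trans (cong (λ z → c * d + z) (coeff-term-* c e q m)) (sym (ℤP.*-distribˡ-+ c d _))
... | yes e+f | no f≢ = ⊥-elim (f≢ (⊕⇒⊖ e f m e+f))
... | no e+f≢ | yes f = ⊥-elim (e+f≢ (trans (cong (e ⊕_) f) (⊕-⊖-cancel e m)))
... | no _    | no _  = coeff-term-* c e q m

coeff-row-++ : ∀ {n} (F : ℤ × Exp n → ℤ × Exp n) q (r : Laurent n) m →
  coeff (map F q ++ r) m ≡ coeff (map F q ++ []) m + coeff r m
coeff-row-++ F q r m = begin
  coeff (map F q ++ r) m                ≡⟨ coeff-++ (map F q) r m ⟩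
  coeff (map F q) m + coeff r m         ≡⟨ cong (_+ coeff r m) (ℤP.+-identityʳ (coeff (map F q) m)) ⟨
  coeff (map F q) m + + 0 + coeff r m   ≡⟨ cong (_+ coeff r m) (coeff-++ (map F q) [] m) ⟨
  coeff (map F q ++ []) m + coeff r m   ∎
  where open ≡-Reasoning

coeff-* : ∀ {n} (p q : Laurent n) m → coeff (p *L q) m ≡ termSum p (λ e → coeff q (m ⊖ e))
coeff-* []            q m = refl
coeff-* ((c , e) ∷ p) q m =
  trans (coeff-row-++ _ q (p *L q) m) (cong₂ _+_ (coeff-term-* c e q m) (coeff-* p q m))

remove : ∀ {n} → Exp n → Laurent n → Laurent n
remove E []            = []
remove E ((c , e) ∷ p) with ≡-dec ℤ._≟_ e E
... | yes _ = remove E p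
... | no _  = (c , e) ∷ remove E p

coeff-remove-at : ∀ {n} (p : Laurent n) E → coeff (remove E p) E ≡ + 0
coeff-remove-at []            E = refl
coeff-remove-at ((c , e) ∷ p) E with ≡-dec ℤ._≟_ e E
... | yes _ = coeff-remove-at p E
... | no e≢E with ≡-dec ℤ._≟_ e E
...   | yes e≡E = ⊥-elim (e≢E e≡E)
...   | no _    = coeff-remove-at p E

coeff-remove-away : ∀ {n} (p : Laurent n) E m → m ≢ E → coeff (remove E p) m ≡ coeff p m
coeff-remove-away []            E m _ = refl
coeff-remove-away ((c , e) ∷ p) E m m≢E with ≡-dec ℤ._≟_ e E
... | yes refl with ≡-dec ℤ._≟_ e m
...   | yes refl = ⊥-elim (m≢E refl)
...   | no _     = coeff-remove-away p E m m≢E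
coeff-remove-away ((c , e) ∷ p) E m m≢E | no _ with ≡-dec ℤ._≟_ e m
...   | yes _ = cong (λ z → c + z) (coeff-remove-away p E m m≢E)
...   | no _  = coeff-remove-away p E m m≢E

length-remove : ∀ {n} (p : Laurent n) E → length (remove E p) ℕ.≤ length p
length-remove []            E = ℕ.z≤n
length-remove ((c , e) ∷ p) E with ≡-dec ℤ._≟_ e E
... | yes _ = ℕP.m≤n⇒m≤1+n (length-remove p E)
... | no _  = ℕ.s≤s (length-remove p E)

length-remove-head : ∀ {n} c E (p : Laurent n) → length (remove E ((c , E) ∷ p)) ℕ.≤ length p
length-remove-head c E p with ≡-dec ℤ._≟_ E E
... | yes _   = length-remove p E
... | no E≢E  = ⊥-elim (E≢E refl)

termSum-split : ∀ {n} (p : Laurent n) g E → termSum p g ≡ coeff p E * g E + termSum (remove E p) g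
termSum-split []            g E = refl
termSum-split ((c , e) ∷ p) g E with ≡-dec ℤ._≟_ e E
... | yes refl = trans (cong (λ z → c * g e + z) (termSum-split p g e)) (collect c (coeff p e) (g e) _)
  where
  collect : ∀ a b x y → a * x + (b * x + y) ≡ (a + b) * x + y
  collect = solve-∀
... | no _ = trans (cong (λ z → c * g e + z) (termSum-split p g E)) (swap (c * g e) (coeff p E * g E) _)
  where
  swap : ∀ a b y → a + (b + y) ≡ b + (a + y)
  swap = solve-∀

termSum-vanish : ∀ {n} (p : Laurent n) g → (∀ e → coeff p e ≡ + 0 ⊎ g e ≡ + 0) → termSum p g ≡ + 0
termSum-vanish p g = within (length p) p ℕP.≤-refl
  where
  within : ∀ k (p : Laurent _) → length p ℕ.≤ k →
           (∀ e → coeff p e ≡ + 0 ⊎ g e ≡ + 0) → termSum p g ≡ + 0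
  within k [] _ _ = refl
  within (suc k) p@((c , E) ∷ q) (ℕ.s≤s len) zero-at = begin
    termSum p g                            ≡⟨ termSum-split p g E ⟩
    coeff p E * g E + termSum (remove E p) g ≡⟨ cong₂ _+_ term-E rest ⟩
    + 0                                    ∎
    where
    open ≡-Reasoning
    term-E : coeff p E * g E ≡ + 0
    term-E with zero-at E
    ... | inj₁ z = trans (cong (_* g E) z) (ℤP.*-zeroˡ (g E))
    ... | inj₂ z = trans (cong (coeff p E *_) z) (ℤP.*-zeroʳ (coeff p E))
    zero-at′ : ∀ e → coeff (remove E p) e ≡ + 0 ⊎ g e ≡ + 0
    zero-at′ e with ≡-dec ℤ._≟_ e E | zero-at e
    ... | yes refl | _      = inj₁ (coeff-remove-at p E)
    ... | no e≢E   | inj₁ z = inj₁ (trans (coeff-remove-away p E e e≢E) z)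
    ... | no _     | inj₂ z = inj₂ z
    rest : termSum (remove E p) g ≡ + 0
    rest = within k (remove E p) (ℕP.≤-trans (length-remove-head c E q) len) zero-at′

pos⇒nonzero : ∀ {a} → + 0 < a → a ≢ + 0
pos⇒nonzero 0<a refl = ℤP.<-irrefl refl 0<a

pos-* : ∀ {a b} → + 0 < a → + 0 < b → + 0 < a * b
pos-* {+ suc _} {+ suc _} _ _ = ℤ.+<+ (ℕ.s≤s ℕ.z≤n)
pos-* {+ zero}  {_}       (ℤ.+<+ ()) _
pos-* {+ suc _} {+ zero}  _ (ℤ.+<+ ())

pos-+ : ∀ {a b} → + 0 < a → + 0 < b → + 0 < a + b
pos-+ = ℤP.+-mono-<

pos-*-cancelʳ : ∀ {a b} → + 0 < b → + 0 < a * b → + 0 < a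
pos-*-cancelʳ {+ suc _}  _ _ = ℤ.+<+ (ℕ.s≤s ℕ.z≤n)
pos-*-cancelʳ {+ zero} {b} _ 0<0*b = ⊥-elim (pos⇒nonzero 0<0*b (ℤP.*-zeroˡ b))
pos-*-cancelʳ { -[1+ _ ]} {+ suc _} _ ()
pos-*-cancelʳ { -[1+ _ ]} {+ zero} (ℤ.+<+ ()) _

nonzero-* : ∀ {a b} → a ≢ + 0 → b ≢ + 0 → a * b ≢ + 0
nonzero-* {a} a≢0 b≢0 ab≡0 with ℤP.i*j≡0⇒i≡0∨j≡0 a ab≡0
... | inj₁ a≡0 = a≢0 a≡0
... | inj₂ b≡0 = b≢0 b≡0

solve-for-first : ∀ {a b c} → a + b ≡ c → a ≡ c - b
solve-for-first {a} {b} refl = cancel a b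
  where
  cancel : ∀ a b → a ≡ a + b - b
  cancel = solve-∀

solve-for-second : ∀ {a b c} → a + b ≡ c → b ≡ c - a
solve-for-second {a} {b} refl = cancel a b
  where
  cancel : ∀ a b → b ≡ a + b - a
  cancel = solve-∀

module MonomialOrder {n : ℕ} (u : Fin n) where

  key : Exp n → Vec ℤ (suc n)
  key m = lookup m u ∷ m

  infix 4 _≺_ _≼_
  _≺_ : Exp n → Exp n → Set
  a ≺ b = key a <lex key b

  _≼_ : Exp n → Exp n → Set
  a ≼ b = a ≺ b ⊎ a ≡ b

  key-⊕ : ∀ a b → key (a ⊕ b) ≡ key a ⊕ key b
  key-⊕ a b = cong (_∷ a ⊕ b) (VP.lookup-zipWith _+_ u a b)

  ≺-irrefl : ∀ {a} → ¬ (a ≺ a)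
  ≺-irrefl = <lex-irrefl

  ≺-trans : ∀ {a b c} → a ≺ b → b ≺ c → a ≺ c
  ≺-trans = <lex-trans

  ≺-compare : ∀ a b → a ≺ b ⊎ a ≡ b ⊎ b ≺ a
  ≺-compare a b with <lex-compare (key a) (key b)
  ... | inj₁ a≺b        = inj₁ a≺b
  ... | inj₂ (inj₁ keq) = inj₂ (inj₁ (VP.∷-injectiveʳ keq))
  ... | inj₂ (inj₂ b≺a) = inj₂ (inj₂ b≺a)

  ≺-⊕ʳ : ∀ {a b} c → a ≺ b → a ⊕ c ≺ b ⊕ c
  ≺-⊕ʳ {a} {b} c a≺b = subst₂ _<lex_ (sym (key-⊕ a c)) (sym (key-⊕ b c)) (<lex-⊕ʳ (key c) a≺b)

  ≺-⊕ˡ : ∀ {a b} c → a ≺ b → c ⊕ a ≺ c ⊕ b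
  ≺-⊕ˡ {a} {b} c a≺b = subst₂ _≺_ (⊕-comm a c) (⊕-comm b c) (≺-⊕ʳ c a≺b)

  ≼-⊕ˡ : ∀ {a b} c → a ≼ b → c ⊕ a ≼ c ⊕ b
  ≼-⊕ˡ c (inj₁ a≺b) = inj₁ (≺-⊕ˡ c a≺b)
  ≼-⊕ˡ c (inj₂ refl) = inj₂ refl

  ≼-trans : ∀ {a b c} → a ≼ b → b ≼ c → a ≼ c
  ≼-trans (inj₁ a≺b) (inj₁ b≺c) = inj₁ (≺-trans a≺b b≺c)
  ≼-trans (inj₁ a≺b) (inj₂ refl) = inj₁ a≺b
  ≼-trans (inj₂ refl) b≼c        = b≼c

  ≼-≺-trans : ∀ {a b c} → a ≼ b → b ≺ c → a ≺ c
  ≼-≺-trans (inj₁ a≺b) b≺c = ≺-trans a≺b b≺c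
  ≼-≺-trans (inj₂ refl) b≺c = b≺c

  ≺-≼-trans : ∀ {a b c} → a ≺ b → b ≼ c → a ≺ c
  ≺-≼-trans a≺b (inj₁ b≺c) = ≺-trans a≺b b≺c
  ≺-≼-trans a≺b (inj₂ refl) = a≺b

  ≼-⊕ : ∀ {a b c d} → a ≼ b → c ≼ d → a ⊕ c ≼ b ⊕ d
  ≼-⊕ {b = b} {c} (inj₁ a≺b) c≼d = inj₁ (≺-≼-trans (≺-⊕ʳ c a≺b) (≼-⊕ˡ b c≼d))
  ≼-⊕ {b = b} (inj₂ refl) c≼d    = ≼-⊕ˡ b c≼d

  ≺-≼-⊕ : ∀ {a b c d} → a ≺ b → c ≼ d → a ⊕ c ≺ b ⊕ d
  ≺-≼-⊕ {b = b} {c} a≺b c≼d = ≺-≼-trans (≺-⊕ʳ c a≺b) (≼-⊕ˡ b c≼d)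

  ≼⇒≯ : ∀ {a b} → a ≼ b → ¬ (b ≺ a)
  ≼⇒≯ a≼b b≺a = ≺-irrefl (≼-≺-trans a≼b b≺a)

  ≼-antisym : ∀ {a b} → a ≼ b → b ≼ a → a ≡ b
  ≼-antisym (inj₂ a≡b) _   = a≡b
  ≼-antisym (inj₁ a≺b) b≼a = ⊥-elim (≼⇒≯ b≼a a≺b)

  ≼⇒deg≤ : ∀ {a b} → a ≼ b → lookup a u ≤ lookup b u
  ≼⇒deg≤ (inj₁ a≺b) = <lex-head a≺b
  ≼⇒deg≤ (inj₂ refl) = ℤP.≤-refl

-- Leading terms of Laurent polynomials

module LeadingTerm {n : ℕ} (u : Fin n) where

  open MonomialOrder u

  Supported : Laurent n → Exp n → Set
  Supported p e = coeff p e ≢ + 0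

  BoundedBy : Laurent n → Exp n → Set
  BoundedBy p M = ∀ e → Supported p e → e ≼ M

  coeff-*-above : ∀ a b {Ma Mb} → BoundedBy a Ma → BoundedBy b Mb →
    ∀ m → Ma ⊕ Mb ≺ m → coeff (a *L b) m ≡ + 0
  coeff-*-above a b {Ma} {Mb} a≼ b≼ m above = trans (coeff-* a b m) (termSum-vanish a _ no-term)
    where
    no-term : ∀ e → coeff a e ≡ + 0 ⊎ coeff b (m ⊖ e) ≡ + 0
    no-term e with coeff a e ℤ.≟ + 0 | coeff b (m ⊖ e) ℤ.≟ + 0
    ... | yes a₀ | _      = inj₁ a₀
    ... | no _   | yes b₀ = inj₂ b₀
    ... | no a≠0 | no b≠0 =
      ⊥-elim (≼⇒≯ (subst (_≼ Ma ⊕ Mb) (⊕-⊖-cancel e m) (≼-⊕ (a≼ e a≠0) (b≼ _ b≠0))) above)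

  coeff-*-top : ∀ a b {Ma Mb} → BoundedBy a Ma → BoundedBy b Mb →
    coeff (a *L b) (Ma ⊕ Mb) ≡ coeff a Ma * coeff b Mb
  coeff-*-top a b {Ma} {Mb} a≼ b≼ = begin
    coeff (a *L b) (Ma ⊕ Mb)                        ≡⟨ coeff-* a b (Ma ⊕ Mb) ⟩
    termSum a g                                      ≡⟨ termSum-split a g Ma ⟩
    coeff a Ma * g Ma + termSum (remove Ma a) g      ≡⟨ cong₂ _+_ top (termSum-vanish (remove Ma a) g no-term) ⟩
    coeff a Ma * coeff b Mb + + 0                    ≡⟨ ℤP.+-identityʳ _ ⟩
    coeff a Ma * coeff b Mb                          ∎
    where
    open ≡-Reasoning
    g : Exp n → ℤ
    g e = coeff b ((Ma ⊕ Mb) ⊖ e)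
    top : coeff a Ma * g Ma ≡ coeff a Ma * coeff b Mb
    top = cong (λ e → coeff a Ma * coeff b e) (sym (⊕⇒⊖ Ma Mb _ refl))
    no-term : ∀ e → coeff (remove Ma a) e ≡ + 0 ⊎ g e ≡ + 0
    no-term e with ≡-dec ℤ._≟_ e Ma
    ... | yes refl = inj₁ (coeff-remove-at a Ma)
    ... | no e≢Ma with coeff a e ℤ.≟ + 0 | g e ℤ.≟ + 0
    ...   | yes a₀ | _      = inj₁ (trans (coeff-remove-away a Ma e e≢Ma) a₀)
    ...   | no _   | yes g₀ = inj₂ g₀
    ...   | no a≠0 | no g≠0 = ⊥-elim (≺-irrefl (subst (_≺ Ma ⊕ Mb) (⊕-⊖-cancel e _) (≺-≼-⊕ e≺Ma (b≼ _ g≠0))))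
      where
      e≺Ma : e ≺ Ma
      e≺Ma with a≼ e a≠0
      ... | inj₁ e≺ = e≺
      ... | inj₂ e≡ = ⊥-elim (e≢Ma e≡)

  BoundedBy-* : ∀ a b {Ma Mb} → BoundedBy a Ma → BoundedBy b Mb → BoundedBy (a *L b) (Ma ⊕ Mb)
  BoundedBy-* a b {Ma} {Mb} a≼ b≼ e supported with ≺-compare e (Ma ⊕ Mb)
  ... | inj₁ e≺        = inj₁ e≺
  ... | inj₂ (inj₁ e≡) = inj₂ e≡
  ... | inj₂ (inj₂ ≺e) = ⊥-elim (supported (coeff-*-above a b a≼ b≼ e ≺e))

  coeff-*-zeroˡ : ∀ (a b : Laurent n) → (∀ m → coeff a m ≡ + 0) → ∀ m → coeff (a *L b) m ≡ + 0
  coeff-*-zeroˡ a b a₀ m = trans (coeff-* a b m) (termSum-vanish a _ (λ e → inj₁ (a₀ e)))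

  coeff-*-zeroʳ : ∀ (a b : Laurent n) → (∀ m → coeff b m ≡ + 0) → ∀ m → coeff (a *L b) m ≡ + 0
  coeff-*-zeroʳ a b b₀ m = trans (coeff-* a b m) (termSum-vanish a _ (λ e → inj₂ (b₀ (m ⊖ e))))

  supported⇒listed : ∀ (p : Laurent n) e → Supported p e → e ∈ map proj₂ p
  supported⇒listed []            e supported = ⊥-elim (supported refl)
  supported⇒listed ((c , f) ∷ p) e supported with ≡-dec ℤ._≟_ f e
  ... | yes refl = here refl
  ... | no _     = there (supported⇒listed p e supported)

  largest-in : ∀ (p : Laurent n) (es : List (Exp n)) →
    (Σ (Exp n) λ M → Supported p M × (∀ e → e ∈ es → Supported p e → e ≼ M)) ⊎
    (∀ e → e ∈ es → ¬ Supported p e)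
  largest-in p [] = inj₂ (λ e ())
  largest-in p (x ∷ es) with coeff p x ℤ.≟ + 0 | largest-in p es
  ... | yes x₀ | inj₂ none = inj₂ λ { e (here refl) s → s x₀ ; e (there e∈) s → none e e∈ s }
  ... | yes x₀ | inj₁ (M , sM , max) =
    inj₁ (M , sM , λ { e (here refl) s → ⊥-elim (s x₀) ; e (there e∈) s → max e e∈ s })
  ... | no sx | inj₂ none =
    inj₁ (x , sx , λ { e (here refl) _ → inj₂ refl ; e (there e∈) s → ⊥-elim (none e e∈ s) })
  ... | no sx | inj₁ (M , sM , max) with ≺-compare x M
  ...   | inj₁ x≺M = inj₁ (M , sM , λ { e (here refl) _ → inj₁ x≺M ; e (there e∈) s → max e e∈ s })
  ...   | inj₂ M≽x = inj₁ (x , sx , λ { e (here refl) _ → inj₂ refl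
                                      ; e (there e∈) s → ≼-trans (max e e∈ s) (flip M≽x) })
    where
    flip : x ≡ M ⊎ M ≺ x → M ≼ x
    flip (inj₁ refl) = inj₂ refl
    flip (inj₂ M≺x)  = inj₁ M≺x

  leading-or-zero : ∀ (p : Laurent n) →
    (Σ (Exp n) λ M → Supported p M × BoundedBy p M) ⊎ (∀ e → coeff p e ≡ + 0)
  leading-or-zero p with largest-in p (map proj₂ p)
  ... | inj₁ (M , sM , max) = inj₁ (M , sM , λ e s → max e (supported⇒listed p e s) s)
  ... | inj₂ none = inj₂ λ e → decidable-stable (coeff p e ℤ.≟ + 0)
                                 (λ s → none e (supported⇒listed p e s) s)

  record PositiveLead (p : Laurent n) (d : ℤ) : Set where
    constructor positiveLead
    field
      lead     : Exp n
      lead-pos : + 0 < coeff p lead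
      lead-max : BoundedBy p lead
      lead-deg : lookup lead u ≡ d

  open PositiveLead

  PositiveLead⇒IsDegMax : ∀ {p d} → PositiveLead p d → IsDegMax u p d
  PositiveLead⇒IsDegMax (positiveLead M pos max deg) =
    (M , pos⇒nonzero pos , deg) , λ m s → subst (lookup m u ≤_) deg (≼⇒deg≤ (max m s))

  PositiveLead-≈ : ∀ {p q d} → PositiveLead p d → p ≈L q → PositiveLead q d
  PositiveLead-≈ (positiveLead M pos max deg) p≈q =
    positiveLead M (subst (+ 0 <_) (p≈q M) pos) (λ e s → max e (λ p₀ → s (trans (sym (p≈q e)) p₀))) deg

  PositiveLead-deg : ∀ {p d d′} → d ≡ d′ → PositiveLead p d → PositiveLead p d′
  PositiveLead-deg refl lp = lp

  PositiveLead-* : ∀ {a b da db} → PositiveLead a da → PositiveLead b db → PositiveLead (a *L b) (da + db)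
  PositiveLead-* {a} {b} (positiveLead Ma pa a≼ ha) (positiveLead Mb pb b≼ hb) =
    positiveLead (Ma ⊕ Mb) (subst (+ 0 <_) (sym (coeff-*-top a b a≼ b≼)) (pos-* pa pb))
      (BoundedBy-* a b a≼ b≼) (trans (VP.lookup-zipWith _+_ u Ma Mb) (cong₂ _+_ ha hb))

  ++-comm-≈ : ∀ (a b : Laurent n) → a ++ b ≈L b ++ a
  ++-comm-≈ a b m = trans (coeff-++ a b m) (trans (ℤP.+-comm (coeff a m) _) (sym (coeff-++ b a m)))

  supported-++ : ∀ a b {e} → Supported (a ++ b) e → Supported a e ⊎ Supported b e
  supported-++ a b {e} s with coeff a e ℤ.≟ + 0
  ... | no sa  = inj₁ sa
  ... | yes a₀ = inj₂ (λ b₀ → s (trans (coeff-++ a b e) (cong₂ _+_ a₀ b₀)))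

  PositiveLead-++-below : ∀ {a b da db} (la : PositiveLead a da) (lb : PositiveLead b db) →
    lead la ≺ lead lb → PositiveLead (a ++ b) (da ⊔ db)
  PositiveLead-++-below {a} {b} {da} {db} (positiveLead Ma pa a≼ ha) (positiveLead Mb pb b≼ hb) Ma≺Mb =
    positiveLead Mb (subst (+ 0 <_) (sym coeff-Mb) pb) bounded
      (trans hb (sym (ℤP.i≤j⇒i⊔j≡j (subst₂ _≤_ ha hb (≼⇒deg≤ (inj₁ Ma≺Mb))))))
    where
    a-at-Mb : coeff a Mb ≡ + 0
    a-at-Mb = decidable-stable (coeff a Mb ℤ.≟ + 0) (λ s → ≼⇒≯ (a≼ Mb s) Ma≺Mb)
    coeff-Mb : coeff (a ++ b) Mb ≡ coeff b Mb
    coeff-Mb = trans (coeff-++ a b Mb) (trans (cong (_+ coeff b Mb) a-at-Mb) (ℤP.+-identityˡ _))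
    bounded : BoundedBy (a ++ b) Mb
    bounded e s with supported-++ a b s
    ... | inj₁ sa = inj₁ (≼-≺-trans (a≼ e sa) Ma≺Mb)
    ... | inj₂ sb = b≼ e sb

  -- Equal leads with positive coefficients cannot cancel.
  PositiveLead-++-equal : ∀ {a b da db} (la : PositiveLead a da) (lb : PositiveLead b db) →
    lead la ≡ lead lb → PositiveLead (a ++ b) (da ⊔ db)
  PositiveLead-++-equal {a} {b} {da} {db} (positiveLead M pa a≼ ha) (positiveLead .M pb b≼ hb) refl =
    positiveLead M (subst (+ 0 <_) (sym (coeff-++ a b M)) (pos-+ pa pb)) bounded
      (trans ha (sym (trans (cong (da ⊔_) (trans (sym hb) ha)) (ℤP.⊔-idem da))))
    where
    bounded : BoundedBy (a ++ b) M
    bounded e s with supported-++ a b s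
    ... | inj₁ sa = a≼ e sa
    ... | inj₂ sb = b≼ e sb

  PositiveLead-++ : ∀ {a b da db} → PositiveLead a da → PositiveLead b db → PositiveLead (a ++ b) (da ⊔ db)
  PositiveLead-++ {a} {b} {da} {db} la lb with ≺-compare (lead la) (lead lb)
  ... | inj₁ a≺b        = PositiveLead-++-below la lb a≺b
  ... | inj₂ (inj₁ a≡b) = PositiveLead-++-equal la lb a≡b
  ... | inj₂ (inj₂ b≺a) =
    PositiveLead-deg (ℤP.⊔-comm db da) (PositiveLead-≈ (PositiveLead-++-below lb la b≺a) (++-comm-≈ b a))

  PositiveLead-term : ∀ {c} (e : Exp n) → + 0 < c → PositiveLead ((c , e) ∷ []) (lookup e u)
  PositiveLead-term {c} e 0<c = positiveLead e (subst (+ 0 <_) (sym coeff-e) 0<c) bounded refl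
    where
    coeff-e : coeff ((c , e) ∷ []) e ≡ c
    coeff-e with ≡-dec ℤ._≟_ e e
    ... | yes _   = ℤP.+-identityʳ c
    ... | no e≢e  = ⊥-elim (e≢e refl)
    bounded : BoundedBy ((c , e) ∷ []) e
    bounded m s with ≡-dec ℤ._≟_ e m
    ... | yes refl = inj₂ refl
    ... | no _     = ⊥-elim (s refl)

  PositiveLead-one : PositiveLead oneL (+ 0)
  PositiveLead-one = PositiveLead-deg (VP.lookup-replicate u (+ 0)) (PositiveLead-term _ (ℤ.+<+ (ℕ.s≤s ℕ.z≤n)))

  PositiveLead-var : ∀ v → PositiveLead (varL v) (δ u v)
  PositiveLead-var v = PositiveLead-deg deg (PositiveLead-term _ (ℤ.+<+ (ℕ.s≤s ℕ.z≤n)))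
    where
    deg : lookup (replicate n (+ 0) [ v ]≔ + 1) u ≡ δ u v
    deg with u Fin.≟ v
    ... | yes refl = VP.lookup∘update u (replicate n (+ 0)) (+ 1)
    ... | no u≢v   = trans (VP.lookup∘update′ u≢v (replicate n (+ 0)) (+ 1)) (VP.lookup-replicate u (+ 0))

  -- Powers multiply the lead degree (x⁰ = 1 needs no hypothesis on x).
  PositiveLead-^ : ∀ {a d} k → (k ≡ 0 ⊎ PositiveLead a d) → PositiveLead (a ^L k) (+ k * d)
  PositiveLead-^ {d = d} zero _ = PositiveLead-deg (sym (ℤP.*-zeroˡ d)) PositiveLead-one
  PositiveLead-^ (suc k) (inj₁ ())
  PositiveLead-^ {d = d} (suc k) (inj₂ la) =
    PositiveLead-deg (unfold k d) (PositiveLead-* la (PositiveLead-^ k (inj₂ la)))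
    where
    unfold : ∀ k d → d + + k * d ≡ + suc k * d
    unfold k d = trans (cong (_+ + k * d) (sym (ℤP.*-identityˡ d))) (sym (ℤP.*-distribʳ-+ d (+ 1) (+ k)))

  PositiveLead-prodL : ∀ (f : Fin n → Laurent n) (m : Fin n → ℕ) (g : Fin n → ℤ) →
    (∀ i → m i ≡ 0 ⊎ PositiveLead (f i) (g i)) → PositiveLead (prodL f m) (sumZ (λ i → + m i * g i))
  PositiveLead-prodL f m g factor = over (allFin n)
    where
    over : ∀ is → PositiveLead (foldr (λ i acc → (f i ^L m i) *L acc) oneL is)
                               (foldr (λ i acc → + m i * g i + acc) (+ 0) is)
    over []       = PositiveLead-one
    over (i ∷ is) = PositiveLead-* (PositiveLead-^ (m i) (factor i)) (over is)

  lead-of-product : ∀ X Y R {Mx My dR} → Supported X Mx → BoundedBy X Mx → Supported Y My → BoundedBy Y My →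
    X *L Y ≈L R → (lR : PositiveLead R dR) →
    lead lR ≡ Mx ⊕ My × coeff R (lead lR) ≡ coeff X Mx * coeff Y My
  lead-of-product X Y R {Mx} {My} sx x≼ sy y≼ XY≈R (positiveLead MR pR R≼ _) = MR≡ , coeff-MR
    where
    coeff-top : coeff R (Mx ⊕ My) ≡ coeff X Mx * coeff Y My
    coeff-top = trans (sym (XY≈R (Mx ⊕ My))) (coeff-*-top X Y x≼ y≼)
    MR≡ : MR ≡ Mx ⊕ My
    MR≡ = ≼-antisym (BoundedBy-* X Y x≼ y≼ MR (λ z → pos⇒nonzero pR (trans (sym (XY≈R MR)) z)))
                    (R≼ _ (λ z → nonzero-* sx sy (trans (sym coeff-top) z)))
    coeff-MR : coeff R MR ≡ coeff X Mx * coeff Y My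
    coeff-MR = trans (cong (coeff R) MR≡) coeff-top

  quotient-deg : ∀ {Ma Mb Mr dr db} → Mr ≡ Ma ⊕ Mb → lookup Mr u ≡ dr → lookup Mb u ≡ db →
    lookup Ma u ≡ dr - db
  quotient-deg {Ma} {Mb} {Mr} {dr} Mr≡ hr hb = trans (solve-for-first degree-sum) (cong (λ d → dr - d) hb)
    where
    degree-sum : lookup Ma u + lookup Mb u ≡ dr
    degree-sum = trans (sym (VP.lookup-zipWith _+_ u Ma Mb)) (trans (cong (λ w → lookup w u) (sym Mr≡)) hr)

  PositiveLead-divʳ : ∀ {a b r db dr} → a *L b ≈L r → PositiveLead b db → PositiveLead r dr →
    PositiveLead a (dr - db)
  PositiveLead-divʳ {a} {b} {r} ab≈r (positiveLead Mb pb b≼ hb) lr with leading-or-zero a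
  ... | inj₂ a₀ = ⊥-elim (pos⇒nonzero (lead-pos lr) (trans (sym (ab≈r _)) (coeff-*-zeroˡ a b a₀ _)))
  ... | inj₁ (Ma , sa , a≼) with lead-of-product a b r sa a≼ (pos⇒nonzero pb) b≼ ab≈r lr
  ...   | Mr≡ , coeff-Mr =
    positiveLead Ma (pos-*-cancelʳ pb (subst (+ 0 <_) coeff-Mr (lead-pos lr))) a≼
      (quotient-deg Mr≡ (lead-deg lr) hb)

  PositiveLead-divˡ : ∀ {a b r db dr} → b *L a ≈L r → PositiveLead b db → PositiveLead r dr →
    PositiveLead a (dr - db)
  PositiveLead-divˡ {a} {b} {r} ba≈r (positiveLead Mb pb b≼ hb) lr with leading-or-zero a
  ... | inj₂ a₀ = ⊥-elim (pos⇒nonzero (lead-pos lr) (trans (sym (ba≈r _)) (coeff-*-zeroʳ b a a₀ _)))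
  ... | inj₁ (Ma , sa , a≼) with lead-of-product b a r (pos⇒nonzero pb) b≼ sa a≼ ba≈r lr
  ...   | Mr≡ , coeff-Mr =
    positiveLead Ma (pos-*-cancelʳ pb (subst (+ 0 <_) (trans coeff-Mr (ℤP.*-comm (coeff b Mb) _)) (lead-pos lr))) a≼
      (quotient-deg (trans Mr≡ (⊕-comm Mb Ma)) (lead-deg lr) hb)

-- Lead degrees along a solution of the T-system

module LeadsAlongTSystem {n : ℕ} (Q : Quiver n) (ε : Fin n → Bool) (bipartite : IsBipartite Q ε)
  (T : Fin n → ℤ → Laurent n) (T-system : IsTSystem Q ε T)
  (u : Fin n) (𝔱 : Fin n → ℤ → ℤ) (𝔱-system : IsTropTSystem Q ε (δ u) 𝔱) where

  open LeadingTerm u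

  -- T v s is a value of the system when s + ε_v is even.
  Active : ℤ → Fin n → Set
  Active s v = EvenZ (s + εℤ (ε v))

  LeadsAt : ℤ → Set
  LeadsAt s = ∀ v → Active s v → PositiveLead (T v s) (𝔱 v s)

  initial : ∀ v s → s ≡ εℤ (ε v) → PositiveLead (T v s) (𝔱 v s)
  initial v _ refl =
    PositiveLead-deg (sym (proj₁ 𝔱-system v))
      (PositiveLead-≈ (PositiveLead-var v) (λ m → sym (proj₁ T-system v m)))

  leads-at-0 : LeadsAt (+ 0)
  leads-at-0 v active with ε v in εv
  ... | false = initial v (+ 0) (cong εℤ (sym εv))
  ... | true  = ⊥-elim (odd-one active)

  leads-at-1 : LeadsAt (+ 1)
  leads-at-1 v active with ε v in εv
  ... | true  = initial v (+ 1) (cong εℤ (sym εv))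
  ... | false = ⊥-elim (odd-one active)

  -- In a bipartite quiver, the neighbours of an inactive vertex are active.
  in-factors : ∀ s v → ¬ Active s v → LeadsAt s →
    ∀ w → arr Q w v ≡ 0 ⊎ PositiveLead (T w s) (𝔱 w s)
  in-factors s v inactive leads w with arr Q w v ℕ.≟ 0
  ... | yes none = inj₁ none
  ... | no some  = inj₂ (leads w (parity-flip s (ε w) (ε v) inactive (bipartite w v (ℕP.n≢0⇒n>0 some))))

  out-factors : ∀ s v → ¬ Active s v → LeadsAt s →
    ∀ w → arr Q v w ≡ 0 ⊎ PositiveLead (T w s) (𝔱 w s)
  out-factors s v inactive leads w with arr Q v w ℕ.≟ 0
  ... | yes none = inj₁ none
  ... | no some  = inj₂ (leads w (parity-flip s (ε w) (ε v) inactive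
                                   (λ εw≡εv → bipartite v w (ℕP.n≢0⇒n>0 some) (sym εw≡εv))))

  exchange-rhs : ∀ s v → ¬ Active s v → LeadsAt s →
    PositiveLead (prodL (λ w → T w s) (λ w → arr Q w v) +L prodL (λ w → T w s) (λ w → arr Q v w))
                 (sumZ (λ w → + arr Q w v * 𝔱 w s) ⊔ sumZ (λ w → + arr Q v w * 𝔱 w s))
  exchange-rhs s v inactive leads =
    PositiveLead-++ (PositiveLead-prodL _ _ _ (in-factors s v inactive leads))
                    (PositiveLead-prodL _ _ _ (out-factors s v inactive leads))

  -- Both recurrences divide the same right-hand side by the known neighbour
  -- in time, so the invariant propagates forwards ...
  step-forward : ∀ s → LeadsAt (s - + 1) → LeadsAt s → LeadsAt (s + + 1)
  step-forward s before now v active with parity-after s (εℤ (ε v)) active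
  ... | inactive , active-before =
    PositiveLead-deg (sym (solve-for-first (proj₂ 𝔱-system v s inactive)))
      (PositiveLead-divʳ (proj₂ T-system v s inactive) (before v active-before) (exchange-rhs s v inactive now))

  -- ... and backwards.
  step-backward : ∀ s → LeadsAt s → LeadsAt (s + + 1) → LeadsAt (s - + 1)
  step-backward s now after v active with parity-before s (εℤ (ε v)) active
  ... | inactive , active-after =
    PositiveLead-deg (sym (solve-for-second (proj₂ 𝔱-system v s inactive)))
      (PositiveLead-divˡ (proj₂ T-system v s inactive) (after v active-after) (exchange-rhs s v inactive now))

  leads-everywhere : ∀ t → LeadsAt t
  leads-everywhere = ℤ-induction₂ LeadsAt leads-at-0 leads-at-1 step-forward step-backward

-- Recurrence of Q is what makes the T-system solvable; given a solution,
-- the degrees are read off from the leads.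
corollary6p5 : ∀ {n} (Q : Quiver n) (ε : Fin n → Bool) →
    IsBipartite Q ε → IsRecurrent Q ε →
    (T : Fin n → ℤ → Laurent n) → IsTSystem Q ε T →
    (u : Fin n) (𝔱 : Fin n → ℤ → ℤ) → IsTropTSystem Q ε (δ u) 𝔱 →
    ∀ v t → EvenZ (t + εℤ (ε v)) → IsDegMax u (T v t) (𝔱 v t)
corollary6p5 Q ε bipartite _ T T-system u 𝔱 𝔱-system v t active =
  PositiveLead⇒IsDegMax (leads-everywhere t v active)
  where
  open LeadingTerm u using (PositiveLead⇒IsDegMax)
  open LeadsAlongTSystem Q ε bipartite T T-system u 𝔱 𝔱-system using (leads-everywhere)
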